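{- Let $\mathbf{Q}=(L,Q_1,\ldots,Q_n,R)$ be a $(4,2)$-flexipath in a matroid $M$. Then $\mathbf{Q}$ has at most one specially placed step.
   Context: Let $M$ be a matroid on ground set $E$ with rank function $r$. $\lambda(A)=r(A)+r(E-A)-r(M)$; for disjoint $X,Y$, $\sqcap(X,Y)=r(X)+r(Y)-r(X\cup Y)$ and $\sqcap^*(X,Y)$ is the same quantity in $M^*$; $\kappa(X,Y)=\min\{\lambda(Z):X\subseteq Z\subseteq E-Y\}$. A path of $4$-separations is an ordered partition $(L,P_1,\ldots,P_n,R)$ of $E$ with $\kappa(L,R)=3$ and $\lambda(L\cup P_1\cup\cdots\cup P_i)=3$ for all $i\in\{0,\ldots,n\}$; a $4$-flexipath if this holds for every reordering of $P_1,\ldots,P_n$ (with $L,R$ fixed); a $(4,2)$-flexipath if moreover $\lambda(P_i)=2$ for all $i$ and $\lambda(P_i\cup P_j)>2$ for all distinct $i,j$. A step $Q_i$ of $\mathbf{Q}$ is specially placed if either (S1) $\sqcap(L,R)=2$ and $\sqcap(L,Q_i)=2=\sqcap(R,Q_i)$, or (S2) $\sqcap^*(L,R)=2$ and $\sqcap^*(L,Q_i)=2=\sqcap^*(R,Q_i)$. -}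

module Defs where

open import Data.Nat using (ℕ; _+_; _∸_; _≤_)
open import Data.Fin using (Fin; toℕ)
open import Data.Fin.Subset using (Subset; _⊆_; _∪_; _∩_; ∁; ⊤; ⊥; ∣_∣; ⋃)
open import Data.Fin.Permutation using (Permutation′; _⟨$⟩ʳ_)
open import Data.List using (map; take; allFin)
import Data.Sum
open import Data.Product using (Σ; _×_)
open import Relation.Binary.PropositionalEquality using (_≡_; _≢_)

record Matroid (m : ℕ) : Set where
  field
    r       : Subset m → ℕ
    r-card  : ∀ X → r X ≤ ∣ X ∣
    r-mono  : ∀ X Y → X ⊆ Y → r X ≤ r Y
    r-submod : ∀ X Y → r (X ∪ Y) + r (X ∩ Y) ≤ r X + r Y
open Matroid public

module _ {m : ℕ} (M : Matroid m) where

  rk : ℕ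
  rk = r M ⊤

  -- dual rank: r*(X) = |X| + r(E - X) - r(M)  (never truncated, by the axioms)
  r* : Subset m → ℕ
  r* X = (∣ X ∣ + r M (∁ X)) ∸ rk

  conn : Subset m → ℕ
  conn A = (r M A + r M (∁ A)) ∸ rk

  sqcap : Subset m → Subset m → ℕ
  sqcap X Y = (r M X + r M Y) ∸ r M (X ∪ Y)

  sqcap* : Subset m → Subset m → ℕ
  sqcap* X Y = (r* X + r* Y) ∸ r* (X ∪ Y)

  KappaIs : Subset m → Subset m → ℕ → Set
  KappaIs X Y k =
    Σ (Subset m) (λ Z → X ⊆ Z × Z ∩ Y ≡ ⊥ × conn Z ≡ k)
    × (∀ Z → X ⊆ Z → Z ∩ Y ≡ ⊥ → k ≤ conn Z)

Disjoint : {m : ℕ} → Subset m → Subset m → Set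
Disjoint X Y = X ∩ Y ≡ ⊥

IsOrderedPartition : {m n : ℕ} → Subset m → (Fin n → Subset m) → Subset m → Set
IsOrderedPartition {m} {n} L P R =
  Disjoint L R
  × (∀ i → Disjoint L (P i))
  × (∀ i → Disjoint (P i) R)
  × (∀ i j → i ≢ j → Disjoint (P i) (P j))
  × (L ∪ (⋃ (map P (allFin n)) ∪ R) ≡ ⊤)

prefixUnion : {m n : ℕ} → (Fin n → Subset m) → Permutation′ n → ℕ → Subset m
prefixUnion {n = n} P σ i = ⋃ (take i (map (λ j → P (σ ⟨$⟩ʳ j)) (allFin n)))

-- 4-flexipath: a path of 4-separations for every reordering of the steps
Is4Flexipath : {m n : ℕ} → Matroid m → Subset m → (Fin n → Subset m) → Subset m → Set
Is4Flexipath {n = n} M L P R =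
  IsOrderedPartition L P R
  × KappaIs M L R 3
  × (∀ (σ : Permutation′ n) (i : Fin (Data.Nat.suc n)) →
       conn M (L ∪ prefixUnion P σ (toℕ i)) ≡ 3)

Is42Flexipath : {m n : ℕ} → Matroid m → Subset m → (Fin n → Subset m) → Subset m → Set
Is42Flexipath {n = n} M L P R =
  Is4Flexipath M L P R
  × (∀ i → conn M (P i) ≡ 2)
  × (∀ i j → i ≢ j → 2 Data.Nat.< conn M (P i ∪ P j))

SpeciallyPlaced : {m : ℕ} → Matroid m → Subset m → Subset m → Subset m → Set
SpeciallyPlaced M L R Q =
  (sqcap M L R ≡ 2 × sqcap M L Q ≡ 2 × sqcap M R Q ≡ 2)
  Data.Sum.⊎ (sqcap* M L R ≡ 2 × sqcap* M L Q ≡ 2 × sqcap* M R Q ≡ 2)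

{-# OPTIONS --safe #-}
module Submission where

-- Write ⊓ for sqcap and λ for conn. Submodularity of the rank gives, for all X, Y, Z,
--   ⊓(X,Y) + ⊓(X,Z) ≤ ⊓(Y,Z) + ⊓(X, Y ∪ Z),
-- and, for disjoint X and Y, ⊓(X,Y) ≤ λ(X) and λ(X ∪ Y) + ⊓(X,Y) ≤ λ(X) + λ(Y).
-- Applying the first inequality to (L,A,B), (R,A,B) and (A ∪ B,L,R), and the second to
-- (A ∪ B, L ∪ R), shows that two steps A, B satisfying (S1) have
-- 8 ≤ 2 + λ(A ∪ B) + 2⊓(A,B); with λ(A ∪ B) + ⊓(A,B) ≤ λ(A) + λ(B) = 4 this forces
-- λ(A ∪ B) ≤ 2, contradicting λ(A ∪ B) > 2. Two steps satisfying (S2) are two steps satisfying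
-- (S1) in the dual matroid, which has the same connectivity function. Finally, a step A
-- satisfying (S1) and a step satisfying (S2) give 4 = ⊓(L,A) + ⊓*(L,R) ≤ λ(L) = 3.

open import Defs
import Algebra.Lattice.Properties.BooleanAlgebra as BooleanAlgebraProperties
open import Data.Empty using (⊥-elim) renaming (⊥ to Empty)
open import Data.Fin using (Fin; zero; _≟_)
open import Data.Fin.Permutation using (id)
open import Data.Fin.Subset
  using (Subset; inside; outside; _∈_; _∉_; _⊆_; _∪_; _∩_; ∁; ⊤; ⊥; ∣_∣)
open import Data.Fin.Subset.Properties
  using ( _∈?_; ∉⊥; ⊆⊤; ∣⊥∣≡0; ∣⊤∣≡n; ∣p∣≤n; ∣∁p∣≡n∸∣p∣; p⊆q⇒∣p∣≤∣q∣; p∪∁p≡⊤; p⊆q⇒∁p⊇∁q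
        ; x∈∁p⇒x∉p; x∉p⇒x∈∁p; x∈p∩q⁺; x∈p∪q⁺; x∈p∪q⁻; p⊆p∪q; q⊆p∪q
        ; ∩-comm; ∪-comm; ∪-idem; ∪-identityʳ; ∩-distribʳ-∪; ∪-∩-booleanAlgebra )
open import Data.Nat using (ℕ; suc; _+_; _∸_; _≤_)
open import Data.Nat.Properties
  using ( +-assoc; +-comm; +-suc; +-identityʳ; +-commutativeSemigroup
        ; +-cancelˡ-≡; +-cancelʳ-≡; +-cancelʳ-≤; +-mono-≤; +-monoˡ-≤; +-monoʳ-≤; ∸-monoˡ-≤
        ; m∸n+n≡m; m+n∸n≡m; m+[n∸m]≡n; m≤m+n; n≤0⇒n≡0
        ; ≤-refl; ≤-reflexive; ≤-trans; ≤⇒≯; <⇒≱; module ≤-Reasoning )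
open import Algebra.Properties.CommutativeSemigroup +-commutativeSemigroup
  using (interchange; x∙yz≈y∙xz)
open import Data.Product using (_×_; _,_)
open import Data.Sum using (_⊎_; inj₁; inj₂; [_,_]; [_,_]′)
open import Data.Vec using ([]; _∷_)
open import Function using (_∘_)
open import Relation.Binary.PropositionalEquality
  using (_≡_; refl; sym; trans; cong; cong₂; subst; subst₂; module ≡-Reasoning)
open import Relation.Nullary using (yes; no)

∣p∪q∣+∣p∩q∣≡∣p∣+∣q∣ : ∀ {n} (p q : Subset n) → ∣ p ∪ q ∣ + ∣ p ∩ q ∣ ≡ ∣ p ∣ + ∣ q ∣
∣p∪q∣+∣p∩q∣≡∣p∣+∣q∣ []            []            = refl
∣p∪q∣+∣p∩q∣≡∣p∣+∣q∣ (inside  ∷ p) (inside  ∷ q) =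
  cong suc (trans (+-suc _ _) (trans (cong suc (∣p∪q∣+∣p∩q∣≡∣p∣+∣q∣ p q)) (sym (+-suc _ _))))
∣p∪q∣+∣p∩q∣≡∣p∣+∣q∣ (inside  ∷ p) (outside ∷ q) = cong suc (∣p∪q∣+∣p∩q∣≡∣p∣+∣q∣ p q)
∣p∪q∣+∣p∩q∣≡∣p∣+∣q∣ (outside ∷ p) (inside  ∷ q) =
  trans (cong suc (∣p∪q∣+∣p∩q∣≡∣p∣+∣q∣ p q)) (sym (+-suc _ _))
∣p∪q∣+∣p∩q∣≡∣p∣+∣q∣ (outside ∷ p) (outside ∷ q) = ∣p∪q∣+∣p∩q∣≡∣p∣+∣q∣ p q

∣p∩q∣+∣p∩∁q∣≡∣p∣ : ∀ {n} (p q : Subset n) → ∣ p ∩ q ∣ + ∣ p ∩ ∁ q ∣ ≡ ∣ p ∣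
∣p∩q∣+∣p∩∁q∣≡∣p∣ []            []            = refl
∣p∩q∣+∣p∩∁q∣≡∣p∣ (inside  ∷ p) (inside  ∷ q) = cong suc (∣p∩q∣+∣p∩∁q∣≡∣p∣ p q)
∣p∩q∣+∣p∩∁q∣≡∣p∣ (inside  ∷ p) (outside ∷ q) = trans (+-suc _ _) (cong suc (∣p∩q∣+∣p∩∁q∣≡∣p∣ p q))
∣p∩q∣+∣p∩∁q∣≡∣p∣ (outside ∷ p) (_       ∷ q) = ∣p∩q∣+∣p∩∁q∣≡∣p∣ p q

∣p∣+∣∁p∣≡n : ∀ {n} (p : Subset n) → ∣ p ∣ + ∣ ∁ p ∣ ≡ n
∣p∣+∣∁p∣≡n p = trans (cong (∣ p ∣ +_) (∣∁p∣≡n∸∣p∣ p)) (m+[n∸m]≡n (∣p∣≤n p))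

∣p∪q∣≡∣p∣+∣q∣ : ∀ {n} {p q : Subset n} → Disjoint p q → ∣ p ∪ q ∣ ≡ ∣ p ∣ + ∣ q ∣
∣p∪q∣≡∣p∣+∣q∣ {n} {p} {q} p∩q≡⊥ = begin
  ∣ p ∪ q ∣               ≡⟨ +-identityʳ _ ⟨
  ∣ p ∪ q ∣ + 0           ≡⟨ cong (∣ p ∪ q ∣ +_) (∣⊥∣≡0 n) ⟨
  ∣ p ∪ q ∣ + ∣ ⊥ {n} ∣   ≡⟨ cong (λ s → ∣ p ∪ q ∣ + ∣ s ∣) p∩q≡⊥ ⟨
  ∣ p ∪ q ∣ + ∣ p ∩ q ∣   ≡⟨ ∣p∪q∣+∣p∩q∣≡∣p∣+∣q∣ p q ⟩
  ∣ p ∣ + ∣ q ∣           ∎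
  where open ≡-Reasoning

x∈p⊎x∈∁p : ∀ {n} x (p : Subset n) → x ∈ p ⊎ x ∈ ∁ p
x∈p⊎x∈∁p x p with x ∈? p
... | yes x∈p = inj₁ x∈p
... | no  x∉p = inj₂ (x∉p⇒x∈∁p x∉p)

x∉p∧x∉q⇒x∉p∪q : ∀ {n x} {p q : Subset n} → x ∉ p → x ∉ q → x ∉ p ∪ q
x∉p∧x∉q⇒x∉p∪q {p = p} {q} x∉p x∉q = [ x∉p , x∉q ] ∘ x∈p∪q⁻ p q

∪-⊆ : ∀ {n} {p q s : Subset n} → p ⊆ s → q ⊆ s → p ∪ q ⊆ s
∪-⊆ {p = p} {q} p⊆s q⊆s = [ p⊆s , q⊆s ] ∘ x∈p∪q⁻ p q

Disjoint-sym : ∀ {n} {p q : Subset n} → Disjoint p q → Disjoint q p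
Disjoint-sym {p = p} {q} p∩q≡⊥ = trans (∩-comm q p) p∩q≡⊥

Disjoint-∪ˡ : ∀ {n} {p q s : Subset n} → Disjoint p s → Disjoint q s → Disjoint (p ∪ q) s
Disjoint-∪ˡ {p = p} {q} {s} p∩s≡⊥ q∩s≡⊥ =
  trans (∩-distribʳ-∪ s p q) (trans (cong₂ _∪_ p∩s≡⊥ q∩s≡⊥) (∪-idem ⊥))

Disjoint-∪ʳ : ∀ {n} {p q s : Subset n} → Disjoint p q → Disjoint p s → Disjoint p (q ∪ s)
Disjoint-∪ʳ p∩q≡⊥ p∩s≡⊥ = Disjoint-sym (Disjoint-∪ˡ (Disjoint-sym p∩q≡⊥) (Disjoint-sym p∩s≡⊥))

Disjoint⇒∉ : ∀ {n x} {p q : Subset n} → Disjoint p q → x ∈ p → x ∉ q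
Disjoint⇒∉ p∩q≡⊥ x∈p x∈q = ∉⊥ (subst (_ ∈_) p∩q≡⊥ (x∈p∩q⁺ (x∈p , x∈q)))

Disjoint⇒⊆∁ : ∀ {n} {p q : Subset n} → Disjoint p q → p ⊆ ∁ q
Disjoint⇒⊆∁ p∩q≡⊥ = x∉p⇒x∈∁p ∘ Disjoint⇒∉ p∩q≡⊥

module _ {m : ℕ} (M : Matroid m) where

  open BooleanAlgebraProperties (∪-∩-booleanAlgebra m) using (¬⊤≈⊥)

  r-submod-⊆ : ∀ {U Z} X Y → U ⊆ X ∪ Y → Z ⊆ X → Z ⊆ Y → r M U + r M Z ≤ r M X + r M Y
  r-submod-⊆ X Y U⊆X∪Y Z⊆X Z⊆Y = ≤-trans
    (+-mono-≤ (r-mono M _ _ U⊆X∪Y) (r-mono M _ _ (λ x∈Z → x∈p∩q⁺ (Z⊆X x∈Z , Z⊆Y x∈Z))))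
    (r-submod M X Y)

  r-subadditive : ∀ X Y → r M (X ∪ Y) ≤ r M X + r M Y
  r-subadditive X Y = ≤-trans (m≤m+n _ _) (r-submod M X Y)

  rk≤r+r∁ : ∀ X → rk M ≤ r M X + r M (∁ X)
  rk≤r+r∁ X = subst (λ E → r M E ≤ r M X + r M (∁ X)) (p∪∁p≡⊤ X) (r-subadditive X (∁ X))

  r∁⊤≡0 : r M (∁ ⊤) ≡ 0
  r∁⊤≡0 = n≤0⇒n≡0 (subst (λ E → r M E ≤ 0) (sym ¬⊤≈⊥)
    (≤-trans (r-card M ⊥) (≤-reflexive (∣⊥∣≡0 m))))

  sqcap+r∪≡r+r : ∀ X Y → sqcap M X Y + r M (X ∪ Y) ≡ r M X + r M Y
  sqcap+r∪≡r+r X Y = m∸n+n≡m (r-subadditive X Y)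

  conn+rk≡r+r∁ : ∀ X → conn M X + rk M ≡ r M X + r M (∁ X)
  conn+rk≡r+r∁ X = m∸n+n≡m (rk≤r+r∁ X)

  r*+rk≡∣∣+r∁ : ∀ X → r* M X + rk M ≡ ∣ X ∣ + r M (∁ X)
  r*+rk≡∣∣+r∁ X = m∸n+n≡m (≤-trans (rk≤r+r∁ X) (+-monoˡ-≤ _ (r-card M X)))

  r*-card : ∀ X → r* M X ≤ ∣ X ∣
  r*-card X = ≤-trans (∸-monoˡ-≤ (rk M) (+-monoʳ-≤ ∣ X ∣ (r-mono M _ _ ⊆⊤)))
                      (≤-reflexive (m+n∸n≡m ∣ X ∣ (rk M)))

  r*-mono : ∀ X Y → X ⊆ Y → r* M X ≤ r* M Y
  r*-mono X Y X⊆Y = ∸-monoˡ-≤ (rk M) (begin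
    ∣ X ∣ + r M (∁ X)                   ≤⟨ +-monoʳ-≤ ∣ X ∣ r∁X≤∣Y∩∁X∣+r∁Y ⟩
    ∣ X ∣ + (∣ Y ∩ ∁ X ∣ + r M (∁ Y))   ≡⟨ +-assoc ∣ X ∣ _ _ ⟨
    ∣ X ∣ + ∣ Y ∩ ∁ X ∣ + r M (∁ Y)     ≤⟨ +-monoˡ-≤ (r M (∁ Y)) ∣X∣+∣Y∩∁X∣≤∣Y∣ ⟩
    ∣ Y ∣ + r M (∁ Y)                   ∎)
    where
    open ≤-Reasoning
    ∁X⊆[Y∩∁X]∪∁Y : ∁ X ⊆ (Y ∩ ∁ X) ∪ ∁ Y
    ∁X⊆[Y∩∁X]∪∁Y {x} x∈∁X =
      x∈p∪q⁺ ([ (λ x∈Y → inj₁ (x∈p∩q⁺ (x∈Y , x∈∁X))) , inj₂ ]′ (x∈p⊎x∈∁p x Y))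
    r∁X≤∣Y∩∁X∣+r∁Y : r M (∁ X) ≤ ∣ Y ∩ ∁ X ∣ + r M (∁ Y)
    r∁X≤∣Y∩∁X∣+r∁Y = begin
      r M (∁ X)                       ≤⟨ r-mono M _ _ ∁X⊆[Y∩∁X]∪∁Y ⟩
      r M ((Y ∩ ∁ X) ∪ ∁ Y)           ≤⟨ r-subadditive _ _ ⟩
      r M (Y ∩ ∁ X) + r M (∁ Y)       ≤⟨ +-monoˡ-≤ _ (r-card M _) ⟩
      ∣ Y ∩ ∁ X ∣ + r M (∁ Y)         ∎
    ∣X∣+∣Y∩∁X∣≤∣Y∣ : ∣ X ∣ + ∣ Y ∩ ∁ X ∣ ≤ ∣ Y ∣
    ∣X∣+∣Y∩∁X∣≤∣Y∣ = begin
      ∣ X ∣ + ∣ Y ∩ ∁ X ∣       ≤⟨ +-monoˡ-≤ _ (p⊆q⇒∣p∣≤∣q∣ (λ x∈X → x∈p∩q⁺ (X⊆Y x∈X , x∈X))) ⟩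
      ∣ Y ∩ X ∣ + ∣ Y ∩ ∁ X ∣   ≡⟨ ∣p∩q∣+∣p∩∁q∣≡∣p∣ Y X ⟩
      ∣ Y ∣                     ∎

  r*-submod : ∀ X Y → r* M (X ∪ Y) + r* M (X ∩ Y) ≤ r* M X + r* M Y
  r*-submod X Y = +-cancelʳ-≤ (rk M + rk M) _ _ (begin
    r* M (X ∪ Y) + r* M (X ∩ Y) + (rk M + rk M)
      ≡⟨ interchange (r* M (X ∪ Y)) _ (rk M) _ ⟩
    (r* M (X ∪ Y) + rk M) + (r* M (X ∩ Y) + rk M)
      ≡⟨ cong₂ _+_ (r*+rk≡∣∣+r∁ (X ∪ Y)) (r*+rk≡∣∣+r∁ (X ∩ Y)) ⟩
    (∣ X ∪ Y ∣ + r M (∁ (X ∪ Y))) + (∣ X ∩ Y ∣ + r M (∁ (X ∩ Y)))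
      ≡⟨ interchange (∣ X ∪ Y ∣) _ (∣ X ∩ Y ∣) _ ⟩
    (∣ X ∪ Y ∣ + ∣ X ∩ Y ∣) + (r M (∁ (X ∪ Y)) + r M (∁ (X ∩ Y)))
      ≤⟨ +-mono-≤ (≤-reflexive (∣p∪q∣+∣p∩q∣≡∣p∣+∣q∣ X Y)) r∁-submod ⟩
    (∣ X ∣ + ∣ Y ∣) + (r M (∁ X) + r M (∁ Y))
      ≡⟨ interchange (∣ X ∣) _ (r M (∁ X)) _ ⟩
    (∣ X ∣ + r M (∁ X)) + (∣ Y ∣ + r M (∁ Y))
      ≡⟨ cong₂ _+_ (r*+rk≡∣∣+r∁ X) (r*+rk≡∣∣+r∁ Y) ⟨
    (r* M X + rk M) + (r* M Y + rk M)
      ≡⟨ interchange (r* M X) _ (r* M Y) _ ⟩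
    r* M X + r* M Y + (rk M + rk M) ∎)
    where
    open ≤-Reasoning
    ∁[X∩Y]⊆∁X∪∁Y : ∁ (X ∩ Y) ⊆ ∁ X ∪ ∁ Y
    ∁[X∩Y]⊆∁X∪∁Y {x} x∈∁[X∩Y] = x∈p∪q⁺ ([ (λ x∈X → inj₂ (x∉p⇒x∈∁p λ x∈Y →
        x∈∁p⇒x∉p x∈∁[X∩Y] (x∈p∩q⁺ (x∈X , x∈Y)))) , inj₁ ]′ (x∈p⊎x∈∁p x X))
    r∁-submod : r M (∁ (X ∪ Y)) + r M (∁ (X ∩ Y)) ≤ r M (∁ X) + r M (∁ Y)
    r∁-submod = ≤-trans (≤-reflexive (+-comm (r M (∁ (X ∪ Y))) _))
      (r-submod-⊆ (∁ X) (∁ Y) ∁[X∩Y]⊆∁X∪∁Y (p⊆q⇒∁p⊇∁q (p⊆p∪q Y)) (p⊆q⇒∁p⊇∁q (q⊆p∪q X Y)))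

  dual : Matroid m
  dual = record { r = r* M ; r-card = r*-card ; r-mono = r*-mono ; r-submod = r*-submod }

module _ {m : ℕ} (M : Matroid m) where

  open BooleanAlgebraProperties (∪-∩-booleanAlgebra m) using (¬-involutive)

  rk-dual+rk≡m : rk (dual M) + rk M ≡ m
  rk-dual+rk≡m = begin
    r* M ⊤ + rk M          ≡⟨ r*+rk≡∣∣+r∁ M ⊤ ⟩
    ∣ ⊤ {m} ∣ + r M (∁ ⊤)  ≡⟨ cong₂ _+_ (∣⊤∣≡n m) (r∁⊤≡0 M) ⟩
    m + 0                  ≡⟨ +-identityʳ m ⟩
    m                      ∎
    where open ≡-Reasoning

  conn-dual : ∀ X → conn (dual M) X ≡ conn M X
  conn-dual X = +-cancelʳ-≡ (rk* + t + t) (conn (dual M) X) (conn M X) (begin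
    conn (dual M) X + (rk* + t + t)
      ≡⟨ cong (conn (dual M) X +_) (+-assoc rk* t t) ⟩
    conn (dual M) X + (rk* + (t + t))
      ≡⟨ +-assoc (conn (dual M) X) rk* (t + t) ⟨
    conn (dual M) X + rk* + (t + t)
      ≡⟨ cong (_+ (t + t)) (conn+rk≡r+r∁ (dual M) X) ⟩
    (r* M X + r* M (∁ X)) + (t + t)
      ≡⟨ interchange (r* M X) _ t _ ⟩
    (r* M X + t) + (r* M (∁ X) + t)
      ≡⟨ cong₂ _+_ (r*+rk≡∣∣+r∁ M X) (r*+rk≡∣∣+r∁ M (∁ X)) ⟩
    (∣ X ∣ + r M (∁ X)) + (∣ ∁ X ∣ + r M (∁ (∁ X)))
      ≡⟨ cong (λ Y → ∣ X ∣ + r M (∁ X) + (∣ ∁ X ∣ + r M Y)) (¬-involutive X) ⟩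
    (∣ X ∣ + r M (∁ X)) + (∣ ∁ X ∣ + r M X)
      ≡⟨ interchange (∣ X ∣) _ (∣ ∁ X ∣) _ ⟩
    (∣ X ∣ + ∣ ∁ X ∣) + (r M (∁ X) + r M X)
      ≡⟨ cong₂ _+_ (trans (∣p∣+∣∁p∣≡n X) (sym rk-dual+rk≡m))
                   (trans (+-comm (r M (∁ X)) (r M X)) (sym (conn+rk≡r+r∁ M X))) ⟩
    (rk* + t) + (conn M X + t)
      ≡⟨ x∙yz≈y∙xz (rk* + t) (conn M X) t ⟩
    conn M X + (rk* + t + t)
      ∎)
    where
    open ≡-Reasoning
    t rk* : ℕ
    t   = rk M
    rk* = rk (dual M)

  sqcap-comm : ∀ X Y → sqcap M X Y ≡ sqcap M Y X
  sqcap-comm X Y = cong₂ _∸_ (+-comm (r M X) (r M Y)) (cong (r M) (∪-comm X Y))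

  sqcap+sqcap≤sqcap+sqcap∪ : ∀ X Y Z →
    sqcap M X Y + sqcap M X Z ≤ sqcap M Y Z + sqcap M X (Y ∪ Z)
  sqcap+sqcap≤sqcap+sqcap∪ X Y Z = +-cancelʳ-≤ (r M (X ∪ Y) + r M (X ∪ Z)) _ _ (begin
    sqcap M X Y + sqcap M X Z + (r M (X ∪ Y) + r M (X ∪ Z))
      ≡⟨ interchange (sqcap M X Y) _ (r M (X ∪ Y)) _ ⟩
    (sqcap M X Y + r M (X ∪ Y)) + (sqcap M X Z + r M (X ∪ Z))
      ≡⟨ cong₂ _+_ (sqcap+r∪≡r+r M X Y) (sqcap+r∪≡r+r M X Z) ⟩
    (r M X + r M Y) + (r M X + r M Z)
      ≡⟨ interchange (r M X) _ (r M X) _ ⟩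
    (r M X + r M X) + (r M Y + r M Z)
      ≡⟨ cong (r M X + r M X +_) (sqcap+r∪≡r+r M Y Z) ⟨
    (r M X + r M X) + (sqcap M Y Z + r M (Y ∪ Z))
      ≡⟨ interchange (r M X) _ (sqcap M Y Z) _ ⟩
    (r M X + sqcap M Y Z) + (r M X + r M (Y ∪ Z))
      ≡⟨ cong₂ _+_ (+-comm (sqcap M Y Z) _) (sqcap+r∪≡r+r M X (Y ∪ Z)) ⟨
    (sqcap M Y Z + r M X) + (sqcap M X (Y ∪ Z) + r M (X ∪ Y ∪ Z))
      ≡⟨ interchange (sqcap M Y Z) _ (sqcap M X (Y ∪ Z)) _ ⟩
    (sqcap M Y Z + sqcap M X (Y ∪ Z)) + (r M X + r M (X ∪ Y ∪ Z))
      ≤⟨ +-monoʳ-≤ (sqcap M Y Z + sqcap M X (Y ∪ Z))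
           (≤-trans (≤-reflexive (+-comm (r M X) _)) submod) ⟩
    (sqcap M Y Z + sqcap M X (Y ∪ Z)) + (r M (X ∪ Y) + r M (X ∪ Z))
      ∎)
    where
    open ≤-Reasoning
    submod : r M (X ∪ Y ∪ Z) + r M X ≤ r M (X ∪ Y) + r M (X ∪ Z)
    submod = r-submod-⊆ M (X ∪ Y) (X ∪ Z)
      (∪-⊆ (p⊆p∪q _ ∘ p⊆p∪q Y) (∪-⊆ (p⊆p∪q _ ∘ q⊆p∪q X Y) (q⊆p∪q _ _ ∘ q⊆p∪q X Z)))
      (p⊆p∪q Y) (p⊆p∪q Z)

  sqcap≤conn : ∀ {X Y} → Disjoint X Y → sqcap M X Y ≤ conn M X
  sqcap≤conn {X} {Y} X∩Y≡⊥ = +-cancelʳ-≤ (r M (X ∪ Y) + rk M) _ _ (begin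
    sqcap M X Y + (r M (X ∪ Y) + rk M)    ≡⟨ +-assoc (sqcap M X Y) _ _ ⟨
    sqcap M X Y + r M (X ∪ Y) + rk M      ≡⟨ cong (_+ rk M) (sqcap+r∪≡r+r M X Y) ⟩
    r M X + r M Y + rk M                  ≡⟨ +-assoc (r M X) _ _ ⟩
    r M X + (r M Y + rk M)                ≡⟨ cong (r M X +_) (+-comm (r M Y) _) ⟩
    r M X + (rk M + r M Y)                ≤⟨ +-monoʳ-≤ (r M X) submod ⟩
    r M X + (r M (X ∪ Y) + r M (∁ X))     ≡⟨ x∙yz≈y∙xz (r M X) (r M (X ∪ Y)) (r M (∁ X)) ⟩
    r M (X ∪ Y) + (r M X + r M (∁ X))     ≡⟨ cong (r M (X ∪ Y) +_) (conn+rk≡r+r∁ M X) ⟨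
    r M (X ∪ Y) + (conn M X + rk M)       ≡⟨ x∙yz≈y∙xz (r M (X ∪ Y)) (conn M X) (rk M) ⟩
    conn M X + (r M (X ∪ Y) + rk M)       ∎)
    where
    open ≤-Reasoning
    submod : rk M + r M Y ≤ r M (X ∪ Y) + r M (∁ X)
    submod = r-submod-⊆ M (X ∪ Y) (∁ X)
      (λ {x} _ → x∈p∪q⁺ ([ inj₁ ∘ p⊆p∪q Y , inj₂ ]′ (x∈p⊎x∈∁p x X)))
      (q⊆p∪q X Y) (Disjoint⇒⊆∁ (Disjoint-sym X∩Y≡⊥))

  conn∪+sqcap≤conn+conn : ∀ {X Y} → Disjoint X Y →
    conn M (X ∪ Y) + sqcap M X Y ≤ conn M X + conn M Y
  conn∪+sqcap≤conn+conn {X} {Y} X∩Y≡⊥ = +-cancelʳ-≤ (rk M + rk M) _ _ (begin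
    conn M (X ∪ Y) + sqcap M X Y + (rk M + rk M)
      ≡⟨ interchange (conn M (X ∪ Y)) _ (rk M) _ ⟩
    (conn M (X ∪ Y) + rk M) + (sqcap M X Y + rk M)
      ≡⟨ cong (_+ (sqcap M X Y + rk M)) (conn+rk≡r+r∁ M (X ∪ Y)) ⟩
    (r M (X ∪ Y) + r M (∁ (X ∪ Y))) + (sqcap M X Y + rk M)
      ≡⟨ interchange (r M (X ∪ Y)) _ (sqcap M X Y) _ ⟩
    (r M (X ∪ Y) + sqcap M X Y) + (r M (∁ (X ∪ Y)) + rk M)
      ≡⟨ cong₂ _+_ (trans (+-comm (r M (X ∪ Y)) _) (sqcap+r∪≡r+r M X Y))
                   (+-comm (r M (∁ (X ∪ Y))) _) ⟩
    (r M X + r M Y) + (rk M + r M (∁ (X ∪ Y)))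
      ≤⟨ +-monoʳ-≤ (r M X + r M Y) submod ⟩
    (r M X + r M Y) + (r M (∁ X) + r M (∁ Y))
      ≡⟨ interchange (r M X) _ (r M (∁ X)) _ ⟩
    (r M X + r M (∁ X)) + (r M Y + r M (∁ Y))
      ≡⟨ cong₂ _+_ (conn+rk≡r+r∁ M X) (conn+rk≡r+r∁ M Y) ⟨
    (conn M X + rk M) + (conn M Y + rk M)
      ≡⟨ interchange (conn M X) _ (conn M Y) _ ⟩
    conn M X + conn M Y + (rk M + rk M)
      ∎)
    where
    open ≤-Reasoning
    submod : rk M + r M (∁ (X ∪ Y)) ≤ r M (∁ X) + r M (∁ Y)
    submod = r-submod-⊆ M (∁ X) (∁ Y)
      (λ {x} _ → x∈p∪q⁺ ([ inj₂ ∘ Disjoint⇒⊆∁ X∩Y≡⊥ , inj₁ ]′ (x∈p⊎x∈∁p x X)))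
      (p⊆q⇒∁p⊇∁q (p⊆p∪q Y)) (p⊆q⇒∁p⊇∁q (q⊆p∪q X Y))

  sqcap*+r∁∪+rk≡r∁+r∁ : ∀ {X Y} → Disjoint X Y →
    sqcap* M X Y + r M (∁ (X ∪ Y)) + rk M ≡ r M (∁ X) + r M (∁ Y)
  sqcap*+r∁∪+rk≡r∁+r∁ {X} {Y} X∩Y≡⊥ = +-cancelˡ-≡ (∣ X ∣ + ∣ Y ∣) _ _ (begin
    ∣ X ∣ + ∣ Y ∣ + (sqcap* M X Y + r M (∁ (X ∪ Y)) + rk M)
      ≡⟨ +-assoc (∣ X ∣ + ∣ Y ∣) _ _ ⟨
    ∣ X ∣ + ∣ Y ∣ + (sqcap* M X Y + r M (∁ (X ∪ Y))) + rk M
      ≡⟨ cong (_+ rk M) (x∙yz≈y∙xz (∣ X ∣ + ∣ Y ∣) (sqcap* M X Y) (r M (∁ (X ∪ Y)))) ⟩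
    sqcap* M X Y + (∣ X ∣ + ∣ Y ∣ + r M (∁ (X ∪ Y))) + rk M
      ≡⟨ cong (λ k → sqcap* M X Y + (k + r M (∁ (X ∪ Y))) + rk M) (∣p∪q∣≡∣p∣+∣q∣ X∩Y≡⊥) ⟨
    sqcap* M X Y + (∣ X ∪ Y ∣ + r M (∁ (X ∪ Y))) + rk M
      ≡⟨ cong (λ k → sqcap* M X Y + k + rk M) (r*+rk≡∣∣+r∁ M (X ∪ Y)) ⟨
    sqcap* M X Y + (r* M (X ∪ Y) + rk M) + rk M
      ≡⟨ cong (_+ rk M) (+-assoc (sqcap* M X Y) _ _) ⟨
    sqcap* M X Y + r* M (X ∪ Y) + rk M + rk M
      ≡⟨ +-assoc (sqcap* M X Y + r* M (X ∪ Y)) _ _ ⟩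
    sqcap* M X Y + r* M (X ∪ Y) + (rk M + rk M)
      ≡⟨ cong (_+ (rk M + rk M)) (sqcap+r∪≡r+r (dual M) X Y) ⟩
    r* M X + r* M Y + (rk M + rk M)
      ≡⟨ interchange (r* M X) _ (rk M) _ ⟩
    (r* M X + rk M) + (r* M Y + rk M)
      ≡⟨ cong₂ _+_ (r*+rk≡∣∣+r∁ M X) (r*+rk≡∣∣+r∁ M Y) ⟩
    (∣ X ∣ + r M (∁ X)) + (∣ Y ∣ + r M (∁ Y))
      ≡⟨ interchange (∣ X ∣) _ (∣ Y ∣) _ ⟩
    ∣ X ∣ + ∣ Y ∣ + (r M (∁ X) + r M (∁ Y))
      ∎)
    where open ≡-Reasoning

  sqcap+sqcap*≤conn : ∀ {L R A} → Disjoint L R → Disjoint L A → Disjoint A R →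
    sqcap M L A + sqcap* M L R ≤ conn M L
  sqcap+sqcap*≤conn {L} {R} {A} L∩R≡⊥ L∩A≡⊥ A∩R≡⊥ =
    +-cancelʳ-≤ (r M (L ∪ A) + (r M (∁ (L ∪ R)) + rk M)) _ _ (begin
    sqcap M L A + sqcap* M L R + (r M (L ∪ A) + (r M (∁ (L ∪ R)) + rk M))
      ≡⟨ interchange (sqcap M L A) _ (r M (L ∪ A)) _ ⟩
    (sqcap M L A + r M (L ∪ A)) + (sqcap* M L R + (r M (∁ (L ∪ R)) + rk M))
      ≡⟨ cong₂ _+_ (sqcap+r∪≡r+r M L A)
           (trans (sym (+-assoc (sqcap* M L R) _ _)) (sqcap*+r∁∪+rk≡r∁+r∁ L∩R≡⊥)) ⟩
    (r M L + r M A) + (r M (∁ L) + r M (∁ R))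
      ≡⟨ interchange (r M L) _ (r M (∁ L)) _ ⟩
    (r M L + r M (∁ L)) + (r M A + r M (∁ R))
      ≡⟨ cong₂ _+_ (conn+rk≡r+r∁ M L) (+-comm (r M (∁ R)) _) ⟨
    (conn M L + rk M) + (r M (∁ R) + r M A)
      ≤⟨ +-monoʳ-≤ (conn M L + rk M) submod ⟩
    (conn M L + rk M) + (r M (L ∪ A) + r M (∁ (L ∪ R)))
      ≡⟨ +-assoc (conn M L) _ _ ⟩
    conn M L + (rk M + (r M (L ∪ A) + r M (∁ (L ∪ R))))
      ≡⟨ cong (conn M L +_) (trans (+-comm (rk M) _) (+-assoc (r M (L ∪ A)) _ _)) ⟩
    conn M L + (r M (L ∪ A) + (r M (∁ (L ∪ R)) + rk M))
      ∎)
    where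
    open ≤-Reasoning
    ∁R⊆[L∪A]∪∁[L∪R] : ∁ R ⊆ (L ∪ A) ∪ ∁ (L ∪ R)
    ∁R⊆[L∪A]∪∁[L∪R] {x} x∈∁R = x∈p∪q⁺ ([ inj₁ ∘ p⊆p∪q A ,
      (λ x∈∁L → inj₂ (x∉p⇒x∈∁p (x∉p∧x∉q⇒x∉p∪q (x∈∁p⇒x∉p x∈∁L) (x∈∁p⇒x∉p x∈∁R)))) ]′
      (x∈p⊎x∈∁p x L))
    submod : r M (∁ R) + r M A ≤ r M (L ∪ A) + r M (∁ (L ∪ R))
    submod = r-submod-⊆ M (L ∪ A) (∁ (L ∪ R)) ∁R⊆[L∪A]∪∁[L∪R] (q⊆p∪q L A)
      (Disjoint⇒⊆∁ (Disjoint-∪ʳ (Disjoint-sym L∩A≡⊥) A∩R≡⊥))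

  sqcap-crossing : ∀ {L R A B} → Disjoint (A ∪ B) (L ∪ R) →
    (sqcap M L A + sqcap M L B) + (sqcap M R A + sqcap M R B)
      ≤ sqcap M L R + conn M (A ∪ B) + (sqcap M A B + sqcap M A B)
  sqcap-crossing {L} {R} {A} {B} A∪B∩L∪R≡⊥ = begin
    (sqcap M L A + sqcap M L B) + (sqcap M R A + sqcap M R B)
      ≤⟨ +-mono-≤ (sqcap+sqcap≤sqcap+sqcap∪ L A B) (sqcap+sqcap≤sqcap+sqcap∪ R A B) ⟩
    (sqcap M A B + sqcap M L (A ∪ B)) + (sqcap M A B + sqcap M R (A ∪ B))
      ≡⟨ interchange (sqcap M A B) _ (sqcap M A B) _ ⟩
    (sqcap M A B + sqcap M A B) + (sqcap M L (A ∪ B) + sqcap M R (A ∪ B))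
      ≡⟨ cong (sqcap M A B + sqcap M A B +_)
           (cong₂ _+_ (sqcap-comm L (A ∪ B)) (sqcap-comm R (A ∪ B))) ⟩
    (sqcap M A B + sqcap M A B) + (sqcap M (A ∪ B) L + sqcap M (A ∪ B) R)
      ≤⟨ +-monoʳ-≤ (sqcap M A B + sqcap M A B) (sqcap+sqcap≤sqcap+sqcap∪ (A ∪ B) L R) ⟩
    (sqcap M A B + sqcap M A B) + (sqcap M L R + sqcap M (A ∪ B) (L ∪ R))
      ≤⟨ +-monoʳ-≤ (sqcap M A B + sqcap M A B)
           (+-monoʳ-≤ (sqcap M L R) (sqcap≤conn A∪B∩L∪R≡⊥)) ⟩
    (sqcap M A B + sqcap M A B) + (sqcap M L R + conn M (A ∪ B))
      ≡⟨ +-comm (sqcap M A B + sqcap M A B) _ ⟩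
    sqcap M L R + conn M (A ∪ B) + (sqcap M A B + sqcap M A B)
      ∎
    where open ≤-Reasoning

-- (S2) is (S1) in the dual matroid: sqcap* M and sqcap (dual M) agree definitionally.
SpeciallyPlaced₁ : {m : ℕ} → Matroid m → Subset m → Subset m → Subset m → Set
SpeciallyPlaced₁ M L R Q = sqcap M L R ≡ 2 × sqcap M L Q ≡ 2 × sqcap M R Q ≡ 2

specially-placed₁-pair⇒conn∪≤2 : ∀ {m} (M : Matroid m) {L R A B} →
  Disjoint A B → Disjoint (A ∪ B) (L ∪ R) →
  conn M A ≡ 2 → conn M B ≡ 2 → SpeciallyPlaced₁ M L R A → SpeciallyPlaced₁ M L R B →
  conn M (A ∪ B) ≤ 2
specially-placed₁-pair⇒conn∪≤2 M {A = A} {B} A∩B≡⊥ A∪B∩L∪R≡⊥ conn-A≡2 conn-B≡2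
  (sqcap-LR≡2 , sqcap-LA≡2 , sqcap-RA≡2) (_ , sqcap-LB≡2 , sqcap-RB≡2) =
  conn≤2 (conn M (A ∪ B)) (sqcap M A B)
    (subst₂ _≤_
      (cong₂ _+_ (cong₂ _+_ sqcap-LA≡2 sqcap-LB≡2) (cong₂ _+_ sqcap-RA≡2 sqcap-RB≡2))
      (cong (λ s → s + conn M (A ∪ B) + (sqcap M A B + sqcap M A B)) sqcap-LR≡2)
      (sqcap-crossing M A∪B∩L∪R≡⊥))
    (subst (conn M (A ∪ B) + sqcap M A B ≤_) (cong₂ _+_ conn-A≡2 conn-B≡2)
      (conn∪+sqcap≤conn+conn M A∩B≡⊥))
  where
  conn≤2 : ∀ c p → 8 ≤ 2 + c + (p + p) → c + p ≤ 4 → c ≤ 2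
  conn≤2 c p h₁ h₂ = +-cancelʳ-≤ (c + (p + p)) c 2 (begin
    c + (c + (p + p))    ≡⟨ +-assoc c c (p + p) ⟨
    (c + c) + (p + p)    ≡⟨ interchange c p c p ⟨
    (c + p) + (c + p)    ≤⟨ +-mono-≤ h₂ h₂ ⟩
    8                    ≤⟨ h₁ ⟩
    2 + c + (p + p)      ∎)
    where open ≤-Reasoning

specially-placed₂-pair⇒conn∪≤2 : ∀ {m} (M : Matroid m) {L R A B} →
  Disjoint A B → Disjoint (A ∪ B) (L ∪ R) →
  conn M A ≡ 2 → conn M B ≡ 2 →
  SpeciallyPlaced₁ (dual M) L R A → SpeciallyPlaced₁ (dual M) L R B →
  conn M (A ∪ B) ≤ 2
specially-placed₂-pair⇒conn∪≤2 M {A = A} {B} A∩B≡⊥ A∪B∩L∪R≡⊥ conn-A≡2 conn-B≡2 placed-A placed-B =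
  subst (_≤ 2) (conn-dual M (A ∪ B))
    (specially-placed₁-pair⇒conn∪≤2 (dual M) A∩B≡⊥ A∪B∩L∪R≡⊥
      (trans (conn-dual M A) conn-A≡2) (trans (conn-dual M B) conn-B≡2) placed-A placed-B)

specially-placed₁₂⇒4≤conn : ∀ {m} (M : Matroid m) {L R A B} →
  Disjoint L R → Disjoint L A → Disjoint A R →
  SpeciallyPlaced₁ M L R A → SpeciallyPlaced₁ (dual M) L R B → 4 ≤ conn M L
specially-placed₁₂⇒4≤conn M {L} L∩R≡⊥ L∩A≡⊥ A∩R≡⊥ (_ , sqcap-LA≡2 , _) (sqcap*-LR≡2 , _ , _) =
  subst (_≤ conn M L) (cong₂ _+_ sqcap-LA≡2 sqcap*-LR≡2) (sqcap+sqcap*≤conn M L∩R≡⊥ L∩A≡⊥ A∩R≡⊥)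

lemma5p1 : {m n : ℕ} (M : Matroid m) (L R : Subset m) (Q : Fin n → Subset m) →
    Is42Flexipath M L Q R →
    ∀ i j → SpeciallyPlaced M L R (Q i) → SpeciallyPlaced M L R (Q j) → i ≡ j
lemma5p1 M L R Q (((L∩R≡⊥ , L∩Q≡⊥ , Q∩R≡⊥ , Q∩Q≡⊥ , _) , _ , conn-prefix≡3) , conn-Q≡2 , 2<conn-Q∪Q)
  i j placed-i placed-j with i ≟ j
... | yes i≡j = i≡j
... | no  i≢j = ⊥-elim (not-both placed-i placed-j)
  where
  conn-L≡3 : conn M L ≡ 3
  conn-L≡3 = trans (cong (conn M) (sym (∪-identityʳ L))) (conn-prefix≡3 id zero)
  Qi∪Qj∩L∪R≡⊥ : Disjoint (Q i ∪ Q j) (L ∪ R)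
  Qi∪Qj∩L∪R≡⊥ = Disjoint-∪ˡ (Disjoint-∪ʳ (Disjoint-sym (L∩Q≡⊥ i)) (Q∩R≡⊥ i))
                            (Disjoint-∪ʳ (Disjoint-sym (L∩Q≡⊥ j)) (Q∩R≡⊥ j))
  conn-Qi∪Qj≰2 : conn M (Q i ∪ Q j) ≤ 2 → Empty
  conn-Qi∪Qj≰2 = <⇒≱ (2<conn-Q∪Q i j i≢j)
  conn-L≱4 : 4 ≤ conn M L → Empty
  conn-L≱4 4≤conn-L = ≤⇒≯ (subst (4 ≤_) conn-L≡3 4≤conn-L) ≤-refl
  not-both : SpeciallyPlaced M L R (Q i) → SpeciallyPlaced M L R (Q j) → Empty
  not-both (inj₁ placed₁-i) (inj₁ placed₁-j) = conn-Qi∪Qj≰2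
    (specially-placed₁-pair⇒conn∪≤2 M (Q∩Q≡⊥ i j i≢j) Qi∪Qj∩L∪R≡⊥ (conn-Q≡2 i) (conn-Q≡2 j)
      placed₁-i placed₁-j)
  not-both (inj₂ placed₂-i) (inj₂ placed₂-j) = conn-Qi∪Qj≰2
    (specially-placed₂-pair⇒conn∪≤2 M (Q∩Q≡⊥ i j i≢j) Qi∪Qj∩L∪R≡⊥ (conn-Q≡2 i) (conn-Q≡2 j)
      placed₂-i placed₂-j)
  not-both (inj₁ placed₁-i) (inj₂ placed₂-j) =
    conn-L≱4 (specially-placed₁₂⇒4≤conn M L∩R≡⊥ (L∩Q≡⊥ i) (Q∩R≡⊥ i) placed₁-i placed₂-j)
  not-both (inj₂ placed₂-i) (inj₁ placed₁-j) =
    conn-L≱4 (specially-placed₁₂⇒4≤conn M L∩R≡⊥ (L∩Q≡⊥ j) (Q∩R≡⊥ j) placed₁-j placed₂-i)
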